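{- A function $f\colon[0,1]\to\mathbb{R}$ has a continuous modulus if and only if $f$ has a continuous ternary modulus.
   Context: The setting is constructive. Real numbers are regular sequences of rationals $\langle r_n\rangle$ with $|r_n-r_{n+1}|\le2^{ -(n+1)}$. Equality is $\langle r_n\rangle\simeq\langle q_n\rangle$ iff $\forall n\,|r_{n+1}-q_{n+1}|\le2^{ -n}$. Functions $[0,1]\to\mathbb{R}$ respect $\simeq$. Modulus: - Fix a bijective coding of $\mathbb{Q}$ by $\mathbb{N}$. Let $|[0,1]|$ be the set of regular sequences in $[0,1]$, viewed as a subset of $\mathbb{N}^{\mathbb{N}}$, with pointwise equality of sequences (not $\simeq$). - A modulus of $f$ is $g\colon\mathbb{N}\to|[0,1]|\to\mathbb{N}$ such that $\forall k\,\forall x,y\in[0,1]\,(|x-y|\le2^{ -g_k(x)}\to|f(x)-f(y)|\le2^{ -k})$. - It is continuous if each $g_k$ is pointwise continuous: $\forall x\,\exists n\,\forall y\,(\overline{x}n=\overline{y}n\to g_k(x)=g_k(y))$. Ternary modulus: - For $s\in\{0,1,2\}^*$, define $N(\langle\rangle)=1$ and $N(s*\langle i\rangle)=2N(s)+(i-1)$. - For $\alpha\in\{0,1,2\}^{\mathbb{N}}$, $\Phi(\alpha)=\langle2^{ -(n+1)}N(\overline{\alpha}n)\rangle_n$. - A ternary modulus of $f$ is $g\colon\mathbb{N}\to\{0,1,2\}^{\mathbb{N}}\to\mathbb{N}$ such that $\forall k\,\forall\alpha\,\forall x\in[0,1]\,(|\Phi(\alpha)-x|\le2^{ -g_k(\alpha)}\to|f(\Phi(\alpha))-f(x)|\le2^{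 -k})$. - It is continuous if each $g_k$ is pointwise continuous on $\{0,1,2\}^{\mathbb{N}}$: $\forall\alpha\,\exists n\,\forall\beta\,(\overline{\alpha}n=\overline{\beta}n\to g_k(\alpha)=g_k(\beta))$. -}

module Defs where

open import Data.Nat using (ℕ; zero; suc; _<_)
open import Data.Fin using (Fin; toℕ)
import Data.Fin as Fin
open import Data.Integer using (+_)
open import Data.Rational using (ℚ; 0ℚ; 1ℚ; ½; _+_; _*_; _-_; -_; ∣_∣; _≤_; _/_; _≤?_; NonNegative; nonNegative)
open import Data.Rational.Properties
open import Data.Product using (Σ; _×_; _,_; proj₁; proj₂)
open import Relation.Binary.PropositionalEquality using (_≡_; refl; sym; trans; cong; subst)
open import Relation.Nullary.Decidable using (toWitness)
import Data.Rational.Solver as QS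

pow2⁻ : ℕ → ℚ
pow2⁻ zero    = 1ℚ
pow2⁻ (suc n) = ½ * pow2⁻ n

record ℝ : Set where
  constructor mkℝ
  field
    seq : ℕ → ℚ
    reg : ∀ n → ∣ seq n - seq (suc n) ∣ ≤ pow2⁻ (suc n)
open ℝ public

_≃ℝ_ : ℝ → ℝ → Set
x ≃ℝ y = ∀ n → ∣ seq x (suc n) - seq y (suc n) ∣ ≤ pow2⁻ n

-- |x - y| ≤ 2^{-m}  (real-number order, unfolded on representatives):
--   ∀ n, |x_{n+1} - y_{n+1}| ≤ 2^{-m} + 2^{-n}
-- (for m "= ∞", i.e. bound 0, this is exactly _≃ℝ_)
Dist≤ : ℝ → ℝ → ℕ → Set
Dist≤ x y m = ∀ n → ∣ seq x (suc n) - seq y (suc n) ∣ ≤ pow2⁻ m + pow2⁻ n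

record I01 : Set where
  constructor mkI
  field
    pt  : ℝ
    inI : ∀ n → (0ℚ ≤ seq pt n) × (seq pt n ≤ 1ℚ)
open I01 public

Respects≃ : (I01 → ℝ) → Set
Respects≃ f = ∀ x y → pt x ≃ℝ pt y → f x ≃ℝ f y

-- sequences agree on the first n terms (x̄n = ȳn; via a bijective coding
-- of ℚ by ℕ this is equality of the coded initial segments)
AgreeUpTo : {A : Set} → ℕ → (ℕ → A) → (ℕ → A) → Set
AgreeUpTo n x y = ∀ i → i < n → x i ≡ y i

IsModulus : (I01 → ℝ) → (ℕ → I01 → ℕ) → Set
IsModulus f g = ∀ k (x y : I01) → Dist≤ (pt x) (pt y) (g k x) → Dist≤ (f x) (f y) k

IsContinuousModulus : (ℕ → I01 → ℕ) → Set
IsContinuousModulus g =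
  ∀ k (x : I01) → Σ ℕ λ n → ∀ (y : I01) → AgreeUpTo n (seq (pt x)) (seq (pt y)) → g k x ≡ g k y

HasContinuousModulus : (I01 → ℝ) → Set
HasContinuousModulus f = Σ (ℕ → I01 → ℕ) λ g → IsModulus f g × IsContinuousModulus g

Ternary : Set
Ternary = ℕ → Fin 3

digit : Fin 3 → ℚ
digit i = (+ toℕ i) / 1

N : Ternary → ℕ → ℚ
N α zero    = 1ℚ
N α (suc n) = (+ 2 / 1) * N α n + (digit (α n) - 1ℚ)

Φseq : Ternary → ℕ → ℚ
Φseq α n = pow2⁻ (suc n) * N α n

private
  open QS.+-*-Solver

  d : Fin 3 → ℚ
  d i = digit i - 1ℚ

  d-lo : ∀ i → - 1ℚ ≤ d i
  d-lo Fin.zero = toWitness {a? = - 1ℚ ≤? d Fin.zero} _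
  d-lo (Fin.suc Fin.zero) = toWitness {a? = - 1ℚ ≤? d (Fin.suc Fin.zero)} _
  d-lo (Fin.suc (Fin.suc Fin.zero)) = toWitness {a? = - 1ℚ ≤? d (Fin.suc (Fin.suc Fin.zero))} _

  d-hi : ∀ i → d i ≤ 1ℚ
  d-hi Fin.zero = toWitness {a? = d Fin.zero ≤? 1ℚ} _
  d-hi (Fin.suc Fin.zero) = toWitness {a? = d (Fin.suc Fin.zero) ≤? 1ℚ} _
  d-hi (Fin.suc (Fin.suc Fin.zero)) = toWitness {a? = d (Fin.suc (Fin.suc Fin.zero)) ≤? 1ℚ} _

  pow-nonneg : ∀ n → 0ℚ ≤ pow2⁻ n
  pow-nonneg zero = toWitness {a? = 0ℚ ≤? 1ℚ} _
  pow-nonneg (suc n) = subst (_≤ ½ * pow2⁻ n) (*-zeroʳ ½)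
    (*-monoˡ-≤-nonNeg ½ {{_}} (pow-nonneg n))

  step : ∀ α n → Φseq α (suc n) ≡ Φseq α n + d (α n) * (½ * pow2⁻ (suc n))
  step α n = solve 3 (λ e M D → (con ½ :* e) :* (con (+ 2 / 1) :* M :+ D)
                                 := e :* M :+ D :* (con ½ :* e))
                 refl (pow2⁻ (suc n)) (N α n) (d (α n))

  nn : ∀ n → NonNegative (pow2⁻ n)
  nn n = nonNegative (pow-nonneg n)

  ∣d∣≤1 : ∀ i → ∣ d i ∣ ≤ 1ℚ
  ∣d∣≤1 Fin.zero = toWitness {a? = ∣ d Fin.zero ∣ ≤? 1ℚ} _
  ∣d∣≤1 (Fin.suc Fin.zero) = toWitness {a? = ∣ d (Fin.suc Fin.zero) ∣ ≤? 1ℚ} _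
  ∣d∣≤1 (Fin.suc (Fin.suc Fin.zero)) = toWitness {a? = ∣ d (Fin.suc (Fin.suc Fin.zero)) ∣ ≤? 1ℚ} _

  open ≤-Reasoning

  inv : ∀ α n → (pow2⁻ (suc n) ≤ Φseq α n) × (Φseq α n ≤ 1ℚ - pow2⁻ (suc n))
  inv α zero = toWitness {a? = pow2⁻ 1 ≤? Φseq α 0} _ , toWitness {a? = Φseq α 0 ≤? 1ℚ - pow2⁻ 1} _
  inv α (suc n) = lo , hi
    where
    e = pow2⁻ (suc n)
    h = ½ * e
    P = Φseq α n
    D = d (α n)
    instance _ = nn (suc (suc n))
    lo : h ≤ Φseq α (suc n)
    lo = begin
      h                ≡⟨ solve 1 (λ e → con ½ :* e := e :+ con (- 1ℚ) :* (con ½ :* e)) refl e ⟩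
      e + (- 1ℚ) * h   ≤⟨ +-mono-≤ (proj₁ (inv α n)) (*-monoʳ-≤-nonNeg h (d-lo (α n))) ⟩
      P + D * h        ≡⟨ sym (step α n) ⟩
      Φseq α (suc n)   ∎
    hi : Φseq α (suc n) ≤ 1ℚ - h
    hi = begin
      Φseq α (suc n)      ≡⟨ step α n ⟩
      P + D * h           ≤⟨ +-mono-≤ (proj₂ (inv α n)) (*-monoʳ-≤-nonNeg h (d-hi (α n))) ⟩
      (1ℚ - e) + 1ℚ * h   ≡⟨ solve 1 (λ e → (con 1ℚ :- e) :+ con 1ℚ :* (con ½ :* e) := con 1ℚ :- con ½ :* e) refl e ⟩
      1ℚ - h              ∎

  Φreg : ∀ α n → ∣ Φseq α n - Φseq α (suc n) ∣ ≤ pow2⁻ (suc n)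
  Φreg α n = begin
      ∣ P - Φseq α (suc n) ∣   ≡⟨ cong (λ z → ∣ P - z ∣) (step α n) ⟩
      ∣ P - (P + D * h) ∣      ≡⟨ cong ∣_∣ (solve 2 (λ P x → P :- (P :+ x) := :- x) refl P (D * h)) ⟩
      ∣ - (D * h) ∣            ≡⟨ ∣-p∣≡∣p∣ (D * h) ⟩
      ∣ D * h ∣                ≡⟨ ∣p*q∣≡∣p∣*∣q∣ D h ⟩
      ∣ D ∣ * ∣ h ∣            ≡⟨ cong (∣ D ∣ *_) (0≤p⇒∣p∣≡p (pow-nonneg (suc (suc n)))) ⟩
      ∣ D ∣ * h                ≤⟨ *-monoʳ-≤-nonNeg h (∣d∣≤1 (α n)) ⟩
      1ℚ * h                   ≡⟨ *-identityˡ h ⟩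
      ½ * e                    ≤⟨ *-monoʳ-≤-nonNeg e (toWitness {a? = ½ ≤? 1ℚ} _) ⟩
      1ℚ * e                   ≡⟨ *-identityˡ e ⟩
      e                        ∎
    where
    e = pow2⁻ (suc n)
    h = ½ * e
    P = Φseq α n
    D = d (α n)
    instance _ = nn (suc n)
    instance _ = nn (suc (suc n))

  Φin : ∀ α n → (0ℚ ≤ Φseq α n) × (Φseq α n ≤ 1ℚ)
  Φin α n = ≤-trans (pow-nonneg (suc n)) (proj₁ (inv α n))
          , ≤-trans (proj₂ (inv α n)) (begin
              1ℚ - e        ≡⟨ solve 1 (λ e → con 1ℚ :- e := con 1ℚ :+ :- e) refl e ⟩
              1ℚ + (- e)    ≤⟨ +-monoʳ-≤ 1ℚ (neg-antimono-≤ (pow-nonneg (suc n))) ⟩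
              1ℚ + (- 0ℚ)   ≡⟨ +-identityʳ 1ℚ ⟩
              1ℚ            ∎)
    where e = pow2⁻ (suc n)

Φ : Ternary → I01
Φ α = mkI (mkℝ (Φseq α) (Φreg α)) (Φin α)

IsTernaryModulus : (I01 → ℝ) → (ℕ → Ternary → ℕ) → Set
IsTernaryModulus f g =
  ∀ k (α : Ternary) (x : I01) → Dist≤ (pt (Φ α)) (pt x) (g k α) → Dist≤ (f (Φ α)) (f x) k

IsContinuousTernaryModulus : (ℕ → Ternary → ℕ) → Set
IsContinuousTernaryModulus g =
  ∀ k (α : Ternary) → Σ ℕ λ n → ∀ (β : Ternary) → AgreeUpTo n α β → g k α ≡ g k β

HasContinuousTernaryModulus : (I01 → ℝ) → Set
HasContinuousTernaryModulus f =
  Σ (ℕ → Ternary → ℕ) λ g → IsTernaryModulus f g × IsContinuousTernaryModulus g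

-- A modulus g on |[0,1]| gives the ternary modulus g ∘ Φ, continuous because Φ(α)ₙ
-- only depends on ᾱn. Conversely every x ∈ [0,1] has a ternary expansion α, read off
-- greedily: digit n moves the approximant Φ(α)ₙ by -1, 0 or +1 times 2^-(n+2) towards
-- x_(n+3), which keeps |xⱼ - Φ(α)ₙ| ≤ 2^-(n+1) + 2^-j. Hence Φ(α) ≃ x, and the first n
-- digits of α only depend on the first n + 3 terms of x. A continuous ternary modulus g
-- then yields the continuous modulus x ↦ g_(k+2)(α) + 2, the two extra halvings paying
-- for the triangle inequalities through Φ(α).

module Submission where

open import Defs
open import Data.Nat as ℕ using (ℕ; zero; suc; _≤′_; ≤′-refl; ≤′-step)
import Data.Nat.Properties as ℕP
open import Data.Fin using (Fin)
import Data.Fin as Fin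
open import Data.Integer using (+_)
open import Data.Rational using (ℚ; 0ℚ; 1ℚ; ½; _+_; _*_; _-_; -_; ∣_∣; _≤_; _<_; _/_; _<?_)
open import Data.Rational.Properties
open import Data.Product using (_×_; _,_; proj₁; proj₂)
open import Data.Sum using (inj₁; inj₂)
open import Relation.Nullary using (yes; no)
open import Relation.Nullary.Decidable using (toWitness)
open import Relation.Binary.PropositionalEquality using (_≡_; refl; sym; trans; cong; cong₂; subst)
import Data.Rational.Solver as QS
open QS.+-*-Solver
open ≤-Reasoning

p≤p+q : ∀ p {q} → 0ℚ ≤ q → p ≤ p + q
p≤p+q p {q} 0≤q = begin
  p       ≡⟨ +-identityʳ p ⟨
  p + 0ℚ  ≤⟨ +-monoʳ-≤ p 0≤q ⟩
  p + q   ∎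

p≤q+p : ∀ p {q} → 0ℚ ≤ q → p ≤ q + p
p≤q+p p {q} 0≤q = subst (p ≤_) (+-comm p q) (p≤p+q p 0≤q)

0≤p+q : ∀ {p q} → 0ℚ ≤ p → 0ℚ ≤ q → 0ℚ ≤ p + q
0≤p+q {p} {q} 0≤p 0≤q = ≤-trans 0≤p (p≤p+q p 0≤q)

p≤∣p∣ : ∀ p → p ≤ ∣ p ∣
p≤∣p∣ p with ∣p∣≡p∨∣p∣≡-p p
... | inj₁ ∣p∣≡p = ≤-reflexive (sym ∣p∣≡p)
... | inj₂ ∣p∣≡-p = begin
  p        ≡⟨ solve 1 (λ p → p := :- (:- p)) refl p ⟩
  - (- p)  ≤⟨ neg-antimono-≤ (subst (0ℚ ≤_) ∣p∣≡-p (0≤∣p∣ p)) ⟩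
  0ℚ       ≤⟨ 0≤∣p∣ p ⟩
  ∣ p ∣    ∎

∣p-q∣≡∣q-p∣ : ∀ p q → ∣ p - q ∣ ≡ ∣ q - p ∣
∣p-q∣≡∣q-p∣ p q = trans (cong ∣_∣ (solve 2 (λ p q → p :- q := :- (q :- p)) refl p q)) (∣-p∣≡∣p∣ (q - p))

∣p-r∣≤∣p-q∣+∣q-r∣ : ∀ p q r → ∣ p - r ∣ ≤ ∣ p - q ∣ + ∣ q - r ∣
∣p-r∣≤∣p-q∣+∣q-r∣ p q r = subst (λ z → ∣ z ∣ ≤ ∣ p - q ∣ + ∣ q - r ∣)
  (solve 3 (λ p q r → (p :- q) :+ (q :- r) := p :- r) refl p q r) (∣p+q∣≤∣p∣+∣q∣ (p - q) (q - r))

∣p-t∣≤∣p-q∣+∣q-r∣+∣r-s∣+∣s-t∣ : ∀ p q r s t →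
  ∣ p - t ∣ ≤ ∣ p - q ∣ + (∣ q - r ∣ + (∣ r - s ∣ + ∣ s - t ∣))
∣p-t∣≤∣p-q∣+∣q-r∣+∣r-s∣+∣s-t∣ p q r s t =
  ≤-trans (∣p-r∣≤∣p-q∣+∣q-r∣ p q t) (+-monoʳ-≤ ∣ p - q ∣
  (≤-trans (∣p-r∣≤∣p-q∣+∣q-r∣ q r t) (+-monoʳ-≤ ∣ q - r ∣ (∣p-r∣≤∣p-q∣+∣q-r∣ r s t))))

∣p-q∣≤r⇒p≤q+r : ∀ {p q r} → ∣ p - q ∣ ≤ r → p ≤ q + r
∣p-q∣≤r⇒p≤q+r {p} {q} {r} ∣p-q∣≤r = begin
  p            ≡⟨ solve 2 (λ p q → p := q :+ (p :- q)) refl p q ⟩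
  q + (p - q)  ≤⟨ +-monoʳ-≤ q (≤-trans (p≤∣p∣ (p - q)) ∣p-q∣≤r) ⟩
  q + r        ∎

∣p-q∣≤r⇒q≤p+r : ∀ {p q r} → ∣ p - q ∣ ≤ r → q ≤ p + r
∣p-q∣≤r⇒q≤p+r {p} {q} ∣p-q∣≤r = ∣p-q∣≤r⇒p≤q+r (subst (_≤ _) (∣p-q∣≡∣q-p∣ p q) ∣p-q∣≤r)

p≤q+r∧q≤p+r⇒∣p-q∣≤r : ∀ {p q r} → p ≤ q + r → q ≤ p + r → ∣ p - q ∣ ≤ r
p≤q+r∧q≤p+r⇒∣p-q∣≤r {p} {q} {r} p≤q+r q≤p+r with ∣p∣≡p∨∣p∣≡-p (p - q)
... | inj₁ ∣p-q∣≡p-q = begin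
  ∣ p - q ∣      ≡⟨ ∣p-q∣≡p-q ⟩
  p - q          ≤⟨ +-monoˡ-≤ (- q) p≤q+r ⟩
  (q + r) - q    ≡⟨ solve 2 (λ q r → (q :+ r) :- q := r) refl q r ⟩
  r              ∎
... | inj₂ ∣p-q∣≡q-p = begin
  ∣ p - q ∣      ≡⟨ ∣p-q∣≡q-p ⟩
  - (p - q)      ≡⟨ solve 2 (λ p q → :- (p :- q) := q :- p) refl p q ⟩
  q - p          ≤⟨ +-monoˡ-≤ (- p) q≤p+r ⟩
  (p + r) - p    ≡⟨ solve 2 (λ p r → (p :+ r) :- p := r) refl p r ⟩
  r              ∎

pow2⁻-nonNeg : ∀ n → 0ℚ ≤ pow2⁻ n
pow2⁻-nonNeg zero    = toWitness {a? = 0ℚ ≤? 1ℚ} _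
pow2⁻-nonNeg (suc n) = subst (_≤ ½ * pow2⁻ n) (*-zeroʳ ½) (*-monoˡ-≤-nonNeg ½ (pow2⁻-nonNeg n))

pow2⁻-suc+pow2⁻-suc : ∀ n → pow2⁻ (suc n) + pow2⁻ (suc n) ≡ pow2⁻ n
pow2⁻-suc+pow2⁻-suc n = solve 1 (λ e → con ½ :* e :+ con ½ :* e := e) refl (pow2⁻ n)

pow2⁻-suc≤ : ∀ n → pow2⁻ (suc n) ≤ pow2⁻ n
pow2⁻-suc≤ n = subst (pow2⁻ (suc n) ≤_) (pow2⁻-suc+pow2⁻-suc n) (p≤p+q _ (pow2⁻-nonNeg (suc n)))

pow2⁻-antimono : ∀ {m n} → m ℕ.≤ n → pow2⁻ n ≤ pow2⁻ m
pow2⁻-antimono m≤n = go (ℕP.≤⇒≤′ m≤n)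
  where
  go : ∀ {m n} → m ≤′ n → pow2⁻ n ≤ pow2⁻ m
  go ≤′-refl                  = ≤-refl
  go {n = suc n} (≤′-step m≤′n) = ≤-trans (pow2⁻-suc≤ n) (go m≤′n)

regular-telescope : (x : ℝ) → ∀ i k → ∣ seq x i - seq x (k ℕ.+ i) ∣ ≤ pow2⁻ i - pow2⁻ (k ℕ.+ i)
regular-telescope x i zero = ≤-reflexive (trans (cong ∣_∣ (+-inverseʳ (seq x i))) (sym (+-inverseʳ (pow2⁻ i))))
regular-telescope x i (suc k) = begin
  ∣ seq x i - seq x (suc j) ∣                           ≤⟨ ∣p-r∣≤∣p-q∣+∣q-r∣ (seq x i) (seq x j) (seq x (suc j)) ⟩
  ∣ seq x i - seq x j ∣ + ∣ seq x j - seq x (suc j) ∣  ≤⟨ +-mono-≤ (regular-telescope x i k) (reg x j) ⟩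
  (pow2⁻ i - pow2⁻ j) + ½ * pow2⁻ j                     ≡⟨ solve 2 (λ a e → (a :- e) :+ con ½ :* e := a :- con ½ :* e) refl (pow2⁻ i) (pow2⁻ j) ⟩
  pow2⁻ i - pow2⁻ (suc j)                               ∎
  where j = k ℕ.+ i

regular-∣xᵢ-xₖ₊ᵢ∣≤ : (x : ℝ) → ∀ i k → ∣ seq x i - seq x (k ℕ.+ i) ∣ ≤ pow2⁻ i
regular-∣xᵢ-xₖ₊ᵢ∣≤ x i k = begin
  ∣ seq x i - seq x (k ℕ.+ i) ∣  ≤⟨ regular-telescope x i k ⟩
  pow2⁻ i - pow2⁻ (k ℕ.+ i)      ≤⟨ p≤p+q _ (pow2⁻-nonNeg (k ℕ.+ i)) ⟩
  (pow2⁻ i - pow2⁻ (k ℕ.+ i)) + pow2⁻ (k ℕ.+ i)  ≡⟨ solve 2 (λ a e → (a :- e) :+ e := a) refl (pow2⁻ i) (pow2⁻ (k ℕ.+ i)) ⟩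
  pow2⁻ i                        ∎

regular-∣xᵢ-xⱼ∣≤ : (x : ℝ) → ∀ i j → ∣ seq x i - seq x j ∣ ≤ pow2⁻ i + pow2⁻ j
regular-∣xᵢ-xⱼ∣≤ x i j with ℕP.≤-total i j
... | inj₁ i≤j = begin
  ∣ seq x i - seq x j ∣                  ≡⟨ cong (λ k → ∣ seq x i - seq x k ∣) (ℕP.m∸n+n≡m i≤j) ⟨
  ∣ seq x i - seq x ((j ℕ.∸ i) ℕ.+ i) ∣  ≤⟨ regular-∣xᵢ-xₖ₊ᵢ∣≤ x i (j ℕ.∸ i) ⟩
  pow2⁻ i                                ≤⟨ p≤p+q (pow2⁻ i) (pow2⁻-nonNeg j) ⟩
  pow2⁻ i + pow2⁻ j                      ∎
... | inj₂ j≤i = begin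
  ∣ seq x i - seq x j ∣                  ≡⟨ ∣p-q∣≡∣q-p∣ (seq x i) (seq x j) ⟩
  ∣ seq x j - seq x i ∣                  ≡⟨ cong (λ k → ∣ seq x j - seq x k ∣) (ℕP.m∸n+n≡m j≤i) ⟨
  ∣ seq x j - seq x ((i ℕ.∸ j) ℕ.+ j) ∣  ≤⟨ regular-∣xᵢ-xₖ₊ᵢ∣≤ x j (i ℕ.∸ j) ⟩
  pow2⁻ j                                ≤⟨ p≤q+p (pow2⁻ j) (pow2⁻-nonNeg i) ⟩
  pow2⁻ i + pow2⁻ j                      ∎

Dist≤-sym : ∀ {x y m} → Dist≤ x y m → Dist≤ y x m
Dist≤-sym {x} {y} {m} x≈y n = subst (_≤ pow2⁻ m + pow2⁻ n) (∣p-q∣≡∣q-p∣ (seq x (suc n)) (seq y (suc n))) (x≈y n)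

Dist≤-trans : ∀ {x y z} c → Dist≤ x y (2 ℕ.+ c) → Dist≤ y z (2 ℕ.+ c) → Dist≤ x z c
Dist≤-trans {x} {y} {z} c x≈y y≈z n = begin
  ∣ seq x n₁ - seq z n₁ ∣
    ≤⟨ ∣p-t∣≤∣p-q∣+∣q-r∣+∣r-s∣+∣s-t∣ (seq x n₁) (seq x M₁) (seq y M₁) (seq z M₁) (seq z n₁) ⟩
  ∣ seq x n₁ - seq x M₁ ∣ + (∣ seq x M₁ - seq y M₁ ∣ + (∣ seq y M₁ - seq z M₁ ∣ + ∣ seq z M₁ - seq z n₁ ∣))
    ≤⟨ +-mono-≤ (regular-∣xᵢ-xⱼ∣≤ x n₁ M₁) (+-mono-≤ (x≈y M) (+-mono-≤ (y≈z M) (regular-∣xᵢ-xⱼ∣≤ z M₁ n₁))) ⟩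
  (½ * v + ½ * w) + ((¼u + w) + ((¼u + w) + (½ * w + ½ * v)))
    ≡⟨ solve 3 (λ u v w → (con ½ :* v :+ con ½ :* w) :+ ((con ½ :* (con ½ :* u) :+ w)
                            :+ ((con ½ :* (con ½ :* u) :+ w) :+ (con ½ :* w :+ con ½ :* v)))
                          := (v :+ con ½ :* u) :+ (w :+ w :+ w)) refl u v w ⟩
  (v + ½ * u) + (w + w + w)
    ≤⟨ +-monoʳ-≤ (v + ½ * u) (+-mono-≤ (+-mono-≤ w≤⅛u w≤⅛u) w≤⅛u) ⟩
  (v + ½ * u) + (⅛u + ⅛u + ⅛u)
    ≤⟨ p≤p+q _ (pow2⁻-nonNeg (3 ℕ.+ c)) ⟩
  (v + ½ * u) + (⅛u + ⅛u + ⅛u) + ⅛u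
    ≡⟨ solve 2 (λ u v → (v :+ con ½ :* u) :+ (⅛ u :+ ⅛ u :+ ⅛ u) :+ ⅛ u := u :+ v) refl u v ⟩
  u + v ∎
  where
  n₁ = suc n
  M = n ℕ.+ (3 ℕ.+ c)
  M₁ = suc M
  u = pow2⁻ c
  v = pow2⁻ n
  w = pow2⁻ M
  ¼u = pow2⁻ (2 ℕ.+ c)
  ⅛u = pow2⁻ (3 ℕ.+ c)
  ⅛ = λ u → con ½ :* (con ½ :* (con ½ :* u))
  w≤⅛u : w ≤ ⅛u
  w≤⅛u = pow2⁻-antimono (ℕP.m≤n+m (3 ℕ.+ c) n)

offset : Fin 3 → ℚ
offset i = digit i - 1ℚ

Φseq-suc : ∀ α n → Φseq α (suc n) ≡ Φseq α n + offset (α n) * pow2⁻ (2 ℕ.+ n)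
Φseq-suc α n = solve 3 (λ e M d → (con ½ :* e) :* (con (+ 2 / 1) :* M :+ d) := e :* M :+ d :* (con ½ :* e))
                       refl (pow2⁻ (suc n)) (N α n) (offset (α n))

AgreeUpTo-mono : ∀ {A : Set} {m n} {x y : ℕ → A} → m ℕ.≤ n → AgreeUpTo n x y → AgreeUpTo m x y
AgreeUpTo-mono m≤n x≡y i i<m = x≡y i (ℕP.<-≤-trans i<m m≤n)

N-cong : ∀ {α β} n → AgreeUpTo n α β → N α n ≡ N β n
N-cong zero    _   = refl
N-cong (suc n) α≡β = cong₂ (λ M d → (+ 2 / 1) * M + offset d)
  (N-cong n (AgreeUpTo-mono (ℕP.n≤1+n n) α≡β)) (α≡β n ℕP.≤-refl)

Φ-cong : ∀ {α β} n → AgreeUpTo n α β → AgreeUpTo n (seq (pt (Φ α))) (seq (pt (Φ β)))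
Φ-cong n α≡β i i<n = cong (pow2⁻ (suc i) *_) (N-cong i (AgreeUpTo-mono (ℕP.<⇒≤ i<n) α≡β))

step-up-bound : ∀ {x p q h ε} → ∣ x - p ∣ ≤ (h + h) + ε → ∣ x - q ∣ ≤ ε + ½ * h → p + ½ * h ≤ q →
                ∣ x - (p + h) ∣ ≤ h + ε
step-up-bound {x} {p} {q} {h} {ε} x≈p x≈q p+t≤q = p≤q+r∧q≤p+r⇒∣p-q∣≤r upper lower
  where
  upper : x ≤ (p + h) + (h + ε)
  upper = begin
    x                  ≤⟨ ∣p-q∣≤r⇒p≤q+r x≈p ⟩
    p + ((h + h) + ε)  ≡⟨ solve 3 (λ p h ε → p :+ ((h :+ h) :+ ε) := (p :+ h) :+ (h :+ ε)) refl p h ε ⟩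
    (p + h) + (h + ε)  ∎
  lower : p + h ≤ x + (h + ε)
  lower = begin
    p + h                      ≡⟨ solve 2 (λ p h → p :+ h := (p :+ con ½ :* h) :+ con ½ :* h) refl p h ⟩
    (p + ½ * h) + ½ * h        ≤⟨ +-monoˡ-≤ (½ * h) p+t≤q ⟩
    q + ½ * h                  ≤⟨ +-monoˡ-≤ (½ * h) (∣p-q∣≤r⇒q≤p+r {x} {q} x≈q) ⟩
    (x + (ε + ½ * h)) + ½ * h  ≡⟨ solve 3 (λ x h ε → (x :+ (ε :+ con ½ :* h)) :+ con ½ :* h := x :+ (h :+ ε)) refl x h ε ⟩
    x + (h + ε)                ∎

step-down-bound : ∀ {x p q h ε} → ∣ x - p ∣ ≤ (h + h) + ε → ∣ x - q ∣ ≤ ε + ½ * h → q ≤ p - ½ * h →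
                  ∣ x - (p - h) ∣ ≤ h + ε
step-down-bound {x} {p} {q} {h} {ε} x≈p x≈q q≤p-t = p≤q+r∧q≤p+r⇒∣p-q∣≤r upper lower
  where
  upper : x ≤ (p - h) + (h + ε)
  upper = begin
    x                          ≤⟨ ∣p-q∣≤r⇒p≤q+r x≈q ⟩
    q + (ε + ½ * h)            ≤⟨ +-monoˡ-≤ (ε + ½ * h) q≤p-t ⟩
    (p - ½ * h) + (ε + ½ * h)  ≡⟨ solve 3 (λ p h ε → (p :- con ½ :* h) :+ (ε :+ con ½ :* h) := (p :- h) :+ (h :+ ε)) refl p h ε ⟩
    (p - h) + (h + ε)          ∎
  lower : p - h ≤ x + (h + ε)
  lower = begin
    p - h                    ≤⟨ +-monoˡ-≤ (- h) (∣p-q∣≤r⇒q≤p+r {x} {p} x≈p) ⟩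
    (x + ((h + h) + ε)) - h  ≡⟨ solve 3 (λ x h ε → (x :+ ((h :+ h) :+ ε)) :- h := x :+ (h :+ ε)) refl x h ε ⟩
    x + (h + ε)              ∎

stay-bound : ∀ {x p q h ε} → ∣ x - q ∣ ≤ ε + ½ * h → q ≤ p + ½ * h → p - ½ * h ≤ q → ∣ x - p ∣ ≤ h + ε
stay-bound {x} {p} {q} {h} {ε} x≈q q≤p+t p-t≤q = begin
  ∣ x - p ∣                ≤⟨ ∣p-r∣≤∣p-q∣+∣q-r∣ x q p ⟩
  ∣ x - q ∣ + ∣ q - p ∣    ≤⟨ +-mono-≤ x≈q (p≤q+r∧q≤p+r⇒∣p-q∣≤r q≤p+t p≤q+t) ⟩
  (ε + ½ * h) + ½ * h      ≡⟨ solve 2 (λ h ε → (ε :+ con ½ :* h) :+ con ½ :* h := h :+ ε) refl h ε ⟩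
  h + ε                    ∎
  where
  p≤q+t : p ≤ q + ½ * h
  p≤q+t = begin
    p                    ≡⟨ solve 2 (λ p h → p := (p :- con ½ :* h) :+ con ½ :* h) refl p h ⟩
    (p - ½ * h) + ½ * h  ≤⟨ +-monoˡ-≤ (½ * h) p-t≤q ⟩
    q + ½ * h            ∎

nearestDigit : ℚ → ℚ → ℚ → Fin 3
nearestDigit t p q with p + t <? q
... | yes _ = Fin.suc (Fin.suc Fin.zero)
... | no _ with q <? p - t
...   | yes _ = Fin.zero
...   | no _  = Fin.suc Fin.zero

data NearestDigit (t p q : ℚ) : Fin 3 → Set where
  above  : p + t < q → NearestDigit t p q (Fin.suc (Fin.suc Fin.zero))
  below  : q < p - t → NearestDigit t p q Fin.zero
  within : q ≤ p + t → p - t ≤ q → NearestDigit t p q (Fin.suc Fin.zero)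

nearestDigit-spec : ∀ t p q → NearestDigit t p q (nearestDigit t p q)
nearestDigit-spec t p q with p + t <? q
... | yes p+t<q = above p+t<q
... | no p+t≮q with q <? p - t
...   | yes q<p-t = below q<p-t
...   | no q≮p-t  = within (≮⇒≥ p+t≮q) (≮⇒≥ q≮p-t)

nearestDigit-step : ∀ {x p q h ε} → ∣ x - p ∣ ≤ (h + h) + ε → ∣ x - q ∣ ≤ ε + ½ * h →
                    ∣ x - (p + offset (nearestDigit (½ * h) p q) * h) ∣ ≤ h + ε
nearestDigit-step {x} {p} {q} {h} {ε} x≈p x≈q = bound (nearestDigit-spec (½ * h) p q)
  where
  bound : ∀ {d} → NearestDigit (½ * h) p q d → ∣ x - (p + offset d * h) ∣ ≤ h + ε
  bound (above p+t<q) =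
    subst (λ y → ∣ x - y ∣ ≤ h + ε) (solve 2 (λ p h → p :+ h := p :+ con 1ℚ :* h) refl p h)
          (step-up-bound {x} {p} {q} {h} {ε} x≈p x≈q (<⇒≤ p+t<q))
  bound (below q<p-t) =
    subst (λ y → ∣ x - y ∣ ≤ h + ε) (solve 2 (λ p h → p :- h := p :+ con (- 1ℚ) :* h) refl p h)
          (step-down-bound {x} {p} {q} {h} {ε} x≈p x≈q (<⇒≤ q<p-t))
  bound (within q≤p+t p-t≤q) =
    subst (λ y → ∣ x - y ∣ ≤ h + ε) (solve 2 (λ p h → p := p :+ con 0ℚ :* h) refl p h)
          (stay-bound {x} {p} {q} {h} {ε} x≈q q≤p+t p-t≤q)

-- expansionN x n is N of the first n digits; it is computed alongside the digits
-- because each digit is chosen relative to the approximant Φₙ = 2^-(n+1) N reached so far.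
mutual
  ternaryExpansion : (ℕ → ℚ) → Ternary
  ternaryExpansion x n = nearestDigit (½ * pow2⁻ (2 ℕ.+ n)) (pow2⁻ (suc n) * expansionN x n) (x (3 ℕ.+ n))

  expansionN : (ℕ → ℚ) → ℕ → ℚ
  expansionN x zero    = 1ℚ
  expansionN x (suc n) = (+ 2 / 1) * expansionN x n + offset (ternaryExpansion x n)

N-ternaryExpansion : ∀ x n → N (ternaryExpansion x) n ≡ expansionN x n
N-ternaryExpansion x zero    = refl
N-ternaryExpansion x (suc n) = cong (λ M → (+ 2 / 1) * M + offset (ternaryExpansion x n)) (N-ternaryExpansion x n)

ternaryExpansion-nearest : ∀ x n →
  ternaryExpansion x n ≡ nearestDigit (½ * pow2⁻ (2 ℕ.+ n)) (Φseq (ternaryExpansion x) n) (x (3 ℕ.+ n))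
ternaryExpansion-nearest x n =
  cong (λ M → nearestDigit (½ * pow2⁻ (2 ℕ.+ n)) (pow2⁻ (suc n) * M) (x (3 ℕ.+ n))) (sym (N-ternaryExpansion x n))

Φseq-ternaryExpansion-suc : ∀ x n → Φseq (ternaryExpansion x) (suc n) ≡
  Φseq (ternaryExpansion x) n + offset (nearestDigit (½ * pow2⁻ (2 ℕ.+ n)) (Φseq (ternaryExpansion x) n) (x (3 ℕ.+ n))) * pow2⁻ (2 ℕ.+ n)
Φseq-ternaryExpansion-suc x n = trans (Φseq-suc (ternaryExpansion x) n)
  (cong (λ d → Φseq (ternaryExpansion x) n + offset d * pow2⁻ (2 ℕ.+ n)) (ternaryExpansion-nearest x n))

ternaryExpansion-approx : (x : I01) → ∀ n j →
  ∣ seq (pt x) j - Φseq (ternaryExpansion (seq (pt x))) n ∣ ≤ pow2⁻ (suc n) + pow2⁻ j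
ternaryExpansion-approx x zero j = p≤q+r∧q≤p+r⇒∣p-q∣≤r upper lower
  where
  X = seq (pt x) j
  upper : X ≤ (½ * 1ℚ) * 1ℚ + (½ * 1ℚ + pow2⁻ j)
  upper = begin
    X                ≤⟨ proj₂ (inI x j) ⟩
    1ℚ               ≤⟨ p≤p+q 1ℚ (pow2⁻-nonNeg j) ⟩
    1ℚ + pow2⁻ j     ≡⟨ solve 1 (λ a → con 1ℚ :+ a := (con ½ :* con 1ℚ) :* con 1ℚ :+ (con ½ :* con 1ℚ :+ a)) refl (pow2⁻ j) ⟩
    (½ * 1ℚ) * 1ℚ + (½ * 1ℚ + pow2⁻ j) ∎
  lower : (½ * 1ℚ) * 1ℚ ≤ X + (½ * 1ℚ + pow2⁻ j)
  lower = begin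
    (½ * 1ℚ) * 1ℚ               ≤⟨ p≤q+p _ (0≤p+q (proj₁ (inI x j)) (pow2⁻-nonNeg j)) ⟩
    (X + pow2⁻ j) + (½ * 1ℚ) * 1ℚ ≡⟨ solve 2 (λ X a → (X :+ a) :+ (con ½ :* con 1ℚ) :* con 1ℚ := X :+ (con ½ :* con 1ℚ :+ a)) refl X (pow2⁻ j) ⟩
    X + (½ * 1ℚ + pow2⁻ j)      ∎
ternaryExpansion-approx x (suc n) j =
  subst (λ z → ∣ seq (pt x) j - z ∣ ≤ pow2⁻ (2 ℕ.+ n) + pow2⁻ j)
        (sym (Φseq-ternaryExpansion-suc (seq (pt x)) n))
        (nearestDigit-step {seq (pt x) j} {Φseq (ternaryExpansion (seq (pt x))) n} {seq (pt x) (3 ℕ.+ n)}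
                           {pow2⁻ (2 ℕ.+ n)} {pow2⁻ j}
          (subst (λ e → ∣ seq (pt x) j - Φseq (ternaryExpansion (seq (pt x))) n ∣ ≤ e + pow2⁻ j)
                 (sym (pow2⁻-suc+pow2⁻-suc (suc n))) (ternaryExpansion-approx x n j))
          (regular-∣xᵢ-xⱼ∣≤ (pt x) j (3 ℕ.+ n)))

Dist≤-Φ-ternaryExpansion : (x : I01) → ∀ m → Dist≤ (pt (Φ (ternaryExpansion (seq (pt x))))) (pt x) m
Dist≤-Φ-ternaryExpansion x m n = begin
  ∣ Φseq α (suc n) - X ∣         ≡⟨ ∣p-q∣≡∣q-p∣ (Φseq α (suc n)) X ⟩
  ∣ X - Φseq α (suc n) ∣         ≤⟨ ternaryExpansion-approx x (suc n) (suc n) ⟩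
  pow2⁻ (2 ℕ.+ n) + pow2⁻ (suc n) ≤⟨ +-monoˡ-≤ (pow2⁻ (suc n)) (pow2⁻-suc≤ (suc n)) ⟩
  pow2⁻ (suc n) + pow2⁻ (suc n)  ≡⟨ pow2⁻-suc+pow2⁻-suc n ⟩
  pow2⁻ n                        ≤⟨ p≤q+p (pow2⁻ n) (pow2⁻-nonNeg m) ⟩
  pow2⁻ m + pow2⁻ n              ∎
  where
  α = ternaryExpansion (seq (pt x))
  X = seq (pt x) (suc n)

mutual
  expansionN-cong : ∀ {x y} n → AgreeUpTo (3 ℕ.+ n) x y → expansionN x n ≡ expansionN y n
  expansionN-cong zero          _   = refl
  expansionN-cong {x} {y} (suc n) x≡y = cong₂ (λ M d → (+ 2 / 1) * M + offset d)
    (expansionN-cong {x} {y} n (AgreeUpTo-mono (ℕP.n≤1+n (3 ℕ.+ n)) x≡y)) (ternaryExpansion-cong-at {x} {y} n x≡y)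

  ternaryExpansion-cong-at : ∀ {x y} n → AgreeUpTo (4 ℕ.+ n) x y → ternaryExpansion x n ≡ ternaryExpansion y n
  ternaryExpansion-cong-at n x≡y = cong₂ (λ M q → nearestDigit (½ * pow2⁻ (2 ℕ.+ n)) (pow2⁻ (suc n) * M) q)
    (expansionN-cong n (AgreeUpTo-mono (ℕP.n≤1+n _) x≡y)) (x≡y (3 ℕ.+ n) ℕP.≤-refl)

ternaryExpansion-cong : ∀ {x y} n → AgreeUpTo (3 ℕ.+ n) x y → AgreeUpTo n (ternaryExpansion x) (ternaryExpansion y)
ternaryExpansion-cong n x≡y i i<n = ternaryExpansion-cong-at i (AgreeUpTo-mono (ℕP.+-monoʳ-≤ 3 i<n) x≡y)

continuousModulus⇒continuousTernaryModulus : ∀ f → HasContinuousModulus f → HasContinuousTernaryModulus f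
continuousModulus⇒continuousTernaryModulus f (g , g-mod , g-cont) =
  (λ k α → g k (Φ α)) , (λ k α → g-mod k (Φ α)) , g∘Φ-cont
  where
  g∘Φ-cont : IsContinuousTernaryModulus (λ k α → g k (Φ α))
  g∘Φ-cont k α = let n , gₖ-const = g-cont k (Φ α) in
    n , λ β α≡β → gₖ-const (Φ β) (Φ-cong {α} {β} n α≡β)

continuousTernaryModulus⇒continuousModulus : ∀ f → HasContinuousTernaryModulus f → HasContinuousModulus f
continuousTernaryModulus⇒continuousModulus f (g , g-mod , g-cont) = G , G-mod , G-cont
  where
  expansion : I01 → Ternary
  expansion x = ternaryExpansion (seq (pt x))
  G : ℕ → I01 → ℕ
  G k x = 2 ℕ.+ g (2 ℕ.+ k) (expansion x)
  G-mod : IsModulus f G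
  G-mod k x y x≈y =
    Dist≤-trans {f x} {f (Φ α)} {f y} k (Dist≤-sym {f (Φ α)} {f x} {2 ℕ.+ k} fΦα≈fx) fΦα≈fy
    where
    α = expansion x
    a = g (2 ℕ.+ k) α
    fΦα≈fx : Dist≤ (f (Φ α)) (f x) (2 ℕ.+ k)
    fΦα≈fx = g-mod (2 ℕ.+ k) α x (Dist≤-Φ-ternaryExpansion x a)
    fΦα≈fy : Dist≤ (f (Φ α)) (f y) (2 ℕ.+ k)
    fΦα≈fy = g-mod (2 ℕ.+ k) α y (Dist≤-trans {pt (Φ α)} {pt x} {pt y} a (Dist≤-Φ-ternaryExpansion x (2 ℕ.+ a)) x≈y)
  G-cont : IsContinuousModulus G
  G-cont k x = let n , gₖ-const = g-cont (2 ℕ.+ k) (expansion x) in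
    3 ℕ.+ n , λ y x≡y →
      cong (2 ℕ.+_) (gₖ-const (expansion y) (ternaryExpansion-cong {seq (pt x)} {seq (pt y)} n x≡y))

proposition5p3 : (f : I01 → ℝ) → Respects≃ f →
                 (HasContinuousModulus f → HasContinuousTernaryModulus f)
                 × (HasContinuousTernaryModulus f → HasContinuousModulus f)
proposition5p3 f _ = continuousModulus⇒continuousTernaryModulus f , continuousTernaryModulus⇒continuousModulus f
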